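{- Let $G$ be a finite graph and let $G/\mathcal{R}$ be the maximal twin-free subgraph of $G$. Then $\chi_{rlid}(G)\geq \log_2(\omega(G/\mathcal{R}))+1$.
   Context: For a vertex $x$, $N[x]$ is its closed neighborhood. Distinct vertices $u,v$ are twins if $N[u]=N[v]$; $G/\mathcal{R}$ is the induced subgraph of $G$ obtained by keeping exactly one vertex from each class of the equivalence relation $N[u]=N[v]$. $\omega(H)$ is the maximum size of a clique of $H$. An $rlid$-coloring of $G$ is a map $c:V(G)\to\mathbb{N}$ (not necessarily proper) such that for every pair of adjacent vertices $u,v$ with $N[u]\neq N[v]$ we have $c(N[u])\neq c(N[v])$, where $c(X)=\{c(x):x\in X\}$; $\chi_{rlid}(G)$ is the minimum number of colors in an $rlid$-coloring of $G$. The logarithm is base $2$. -}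

module Defs where

open import Level using (0ℓ)
open import Data.Nat using (ℕ)
open import Data.Fin using (Fin)
open import Data.Product using (Σ; _×_; ∃)
open import Data.Sum using (_⊎_)
open import Data.List using (List)
open import Data.List.Membership.Propositional using (_∈_)
open import Data.List.Relation.Unary.All using (All)
open import Data.List.Relation.Unary.Unique.Propositional using (Unique)
open import Relation.Binary.PropositionalEquality using (_≡_)
open import Relation.Nullary using (¬_)

record Graph (n : ℕ) : Set₁ where
  field
    Adj    : Fin n → Fin n → Set
    sym    : ∀ {u v} → Adj u v → Adj v u
    irrefl : ∀ {u} → ¬ Adj u u

module _ {n : ℕ} (G : Graph n) where
  open Graph G

  N[_] : Fin n → Fin n → Set
  N[ x ] y = (y ≡ x) ⊎ Adj x y

  SameN : Fin n → Fin n → Set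
  SameN u v = ∀ y → (N[ u ] y → N[ v ] y) × (N[ v ] y → N[ u ] y)

  ColorsOf : {k : ℕ} → (Fin n → Fin k) → Fin n → Fin k → Set
  ColorsOf c u i = ∃ λ y → N[ u ] y × c y ≡ i

  SameColors : {k : ℕ} → (Fin n → Fin k) → Fin n → Fin n → Set
  SameColors c u v = ∀ i → (ColorsOf c u i → ColorsOf c v i) × (ColorsOf c v i → ColorsOf c u i)

  IsRlidColoring : {k : ℕ} → (Fin n → Fin k) → Set
  IsRlidColoring c = ∀ u v → Adj u v → ¬ SameN u v → ¬ SameColors c u v

  -- R is a valid choice for the vertex set of G/R: it contains exactly one
  -- vertex of each class of the relation N[u] = N[v].
  IsTwinQuotientSet : (Fin n → Set) → Set
  IsTwinQuotientSet R =
    (∀ x → ∃ λ r → R r × SameN r x) ×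
    (∀ r s → R r → R s → SameN r s → r ≡ s)

  IsCliqueIn : (Fin n → Set) → List (Fin n) → Set
  IsCliqueIn R K =
    Unique K × All R K ×
    (∀ {u v} → u ∈ K → v ∈ K → ¬ u ≡ v → Adj u v)

-- Let c be an rlid-colouring with k colours and K a clique of G/R containing u₀.
-- Distinct vertices of K are adjacent non-twins, so their colour sets c(N[u]) ⊆ Fin k
-- are pairwise distinct, and all of them contain c(u₀). Deleting the colour c(u₀)
-- therefore gives |K| distinct subsets of a (k − 1)-element set, so |K| ≤ 2^(k−1).
module Submission where

open import Defs
open import Data.Bool using (Bool; true)
open import Data.Fin using (Fin; zero; suc; punchIn; punchOut; funToFin; finToFun; _≟_)
open import Data.Fin.Properties
  using (injective⇒≤; punchIn-punchOut; finToFun-funToFin; 2↔Bool)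
open import Data.List using (List; []; _∷_; length; lookup)
open import Data.List.Membership.Propositional using (_∈_)
open import Data.List.Membership.Propositional.Properties using (∈-lookup)
open import Data.List.Relation.Unary.All as All using (All)
open import Data.List.Relation.Unary.AllPairs using (_∷_)
open import Data.List.Relation.Unary.Any using (here)
open import Data.List.Relation.Unary.Unique.Propositional using (Unique)
open import Data.Nat using (ℕ; suc; _*_; _^_; _≤_; z≤n)
open import Data.Nat.Properties using (_≤?_; *-monoʳ-≤)
open import Data.Product using (_,_; proj₁; proj₂)
open import Data.Sum using (inj₁; inj₂)
open import Function using (_∘_)
open import Function.Bundles using (Inverse)
open import Relation.Binary.PropositionalEquality
  using (_≡_; _≗_; refl; sym; trans; cong; module ≡-Reasoning)
open import Relation.Nullary using (¬_; Dec; yes; no; does)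
open import Relation.Nullary.Decidable using (dec-true; decidable-stable)
open import Relation.Nullary.Decidable.Core using (¬¬-excluded-middle)
open import Relation.Nullary.Negation using (contradiction)

¬¬-Π-Fin : ∀ {n} {P : Fin n → Set} → (∀ i → ¬ ¬ P i) → ¬ ¬ (∀ i → P i)
¬¬-Π-Fin {ℕ.zero} ¬¬P ¬∀P = ¬∀P (λ ())
¬¬-Π-Fin {suc n} ¬¬P ¬∀P =
  ¬¬P zero λ P₀ → ¬¬-Π-Fin (¬¬P ∘ suc) λ P₊ → ¬∀P λ { zero → P₀ ; (suc i) → P₊ i }

does≡true⇒ : ∀ {A : Set} (a? : Dec A) → does a? ≡ true → A
does≡true⇒ (yes a) _ = a
does≡true⇒ (no _) ()

Unique⇒lookup-injective : ∀ {A : Set} {xs : List A} → Unique xs →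
  ∀ {i j} → lookup xs i ≡ lookup xs j → i ≡ j
Unique⇒lookup-injective {xs = _ ∷ _} _ {zero} {zero} _ = refl
Unique⇒lookup-injective {xs = _ ∷ _} (x∉ ∷ _) {zero} {suc j} e =
  contradiction e (All.lookup x∉ (∈-lookup j))
Unique⇒lookup-injective {xs = _ ∷ _} (x∉ ∷ _) {suc i} {zero} e =
  contradiction (sym e) (All.lookup x∉ (∈-lookup i))
Unique⇒lookup-injective {xs = _ ∷ _} (_ ∷ u) {suc i} {suc j} e =
  cong suc (Unique⇒lookup-injective u e)

≗-injective⇒≤ : ∀ {m k} (S : Fin m → Fin k → Bool) →
  (∀ {x y} → S x ≗ S y → x ≡ y) → m ≤ 2 ^ k
≗-injective⇒≤ S inj = injective⇒≤ {f = encode ∘ S} (λ e → inj (decode-encode e))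
  where
  open Inverse 2↔Bool using (to; from; strictlyInverseˡ)

  encode : ∀ {k} → (Fin k → Bool) → Fin (2 ^ k)
  encode f = funToFin (from ∘ f)

  decode-encode : ∀ {k} {f g : Fin k → Bool} → encode f ≡ encode g → f ≗ g
  decode-encode {f = f} {g} e i = begin
    f i                                  ≡⟨ strictlyInverseˡ (f i) ⟨
    to (from (f i))                      ≡⟨ cong to (finToFun-funToFin (from ∘ f) i) ⟨
    to (finToFun (encode f) i)           ≡⟨ cong (λ a → to (finToFun a i)) e ⟩
    to (finToFun (encode g) i)           ≡⟨ cong to (finToFun-funToFin (from ∘ g) i) ⟩
    to (from (g i))                      ≡⟨ strictlyInverseˡ (g i) ⟩
    g i                                  ∎
    where open ≡-Reasoning

≗-punchIn⇒≗ : ∀ {k} {A : Set} {f g : Fin (suc k) → A} (i₀ : Fin (suc k)) →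
  f i₀ ≡ g i₀ → f ∘ punchIn i₀ ≗ g ∘ punchIn i₀ → f ≗ g
≗-punchIn⇒≗ {f = f} {g} i₀ same-at-i₀ same-elsewhere i with i₀ ≟ i
... | yes refl = same-at-i₀
... | no i₀≢i = begin
  f i                             ≡⟨ cong f (punchIn-punchOut i₀≢i) ⟨
  f (punchIn i₀ (punchOut i₀≢i))  ≡⟨ same-elsewhere (punchOut i₀≢i) ⟩
  g (punchIn i₀ (punchOut i₀≢i))  ≡⟨ cong g (punchIn-punchOut i₀≢i) ⟩
  g i                             ∎
  where open ≡-Reasoning

-- Subsets that agree at i₀ are determined by their trace on the other k − 1 points.
pointed-≗-injective⇒≤ : ∀ {m k} (S : Fin m → Fin k → Bool) (i₀ : Fin k) {b : Bool} →
  (∀ x → S x i₀ ≡ b) → (∀ {x y} → S x ≗ S y → x ≡ y) → 2 * m ≤ 2 ^ k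
pointed-≗-injective⇒≤ {k = suc _} S i₀ ∋i₀ inj =
  *-monoʳ-≤ 2 (≗-injective⇒≤ (λ x → S x ∘ punchIn i₀) λ {x} {y} e →
    inj (≗-punchIn⇒≗ i₀ (trans (∋i₀ x) (sym (∋i₀ y))) e))

module _ {n} (G : Graph n) {R : Fin n → Set} {K : List (Fin n)} (clique : IsCliqueIn G R K) where
  open Graph G using (Adj)

  clique⇒N[] : ∀ {u v} → u ∈ K → v ∈ K → N[_] G u v
  clique⇒N[] {u} {v} u∈K v∈K with v ≟ u
  ... | yes v≡u = inj₁ v≡u
  ... | no v≢u = inj₂ (proj₂ (proj₂ clique) u∈K v∈K (v≢u ∘ sym))

  rlid-injective-on-clique : IsTwinQuotientSet G R → ∀ {k} {c : Fin n → Fin k} → IsRlidColoring G c →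
    ∀ {u v} → u ∈ K → v ∈ K → SameColors G c u v → u ≡ v
  rlid-injective-on-clique (_ , twin-free) rlid {u} {v} u∈K v∈K same-colours with u ≟ v
  ... | yes u≡v = u≡v
  ... | no u≢v = contradiction same-colours (rlid u v adj non-twins)
    where
    adj : Adj u v
    adj = proj₂ (proj₂ clique) u∈K v∈K u≢v

    non-twins : ¬ SameN G u v
    non-twins = u≢v ∘ twin-free u v (All.lookup in-R u∈K) (All.lookup in-R v∈K)
      where
      in-R : All R K
      in-R = proj₁ (proj₂ clique)

module ColourSets {n k} (G : Graph n) (c : Fin n → Fin k)
  (colour? : ∀ u i → Dec (ColorsOf G c u i)) where

  colourSet : Fin n → Fin k → Bool
  colourSet u i = does (colour? u i)

  colourSet-≗⇒SameColors : ∀ {u v} → colourSet u ≗ colourSet v → SameColors G c u v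
  colourSet-≗⇒SameColors {u} {v} e i = transfer (e i) , transfer (sym (e i))
    where
    transfer : ∀ {x y} → colourSet x i ≡ colourSet y i → ColorsOf G c x i → ColorsOf G c y i
    transfer {x} {y} eq x∋i = does≡true⇒ (colour? y i) (trans (sym eq) (dec-true (colour? x i) x∋i))

  clique-bound : ∀ {R K} → IsTwinQuotientSet G R → IsRlidColoring G c → IsCliqueIn G R K →
    2 * length K ≤ 2 ^ k
  clique-bound {K = []} _ _ _ = z≤n
  clique-bound {K = K@(u₀ ∷ _)} twin-quotient rlid clique =
    pointed-≗-injective⇒≤ (colourSet ∘ lookup K) (c u₀)
      (λ j → dec-true (colour? _ _) (u₀ , clique⇒N[] G clique (∈-lookup j) (here refl) , refl))
      (λ {i} {j} e → Unique⇒lookup-injective (proj₁ clique)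
        (rlid-injective-on-clique G clique twin-quotient rlid (∈-lookup i) (∈-lookup j)
          (colourSet-≗⇒SameColors e)))

-- ColorsOf is not decidable in general, but the bound is a decidable statement,
-- so decidability of all the finitely many colour memberships may be assumed.
mainTheorem9 : (n : ℕ) (G : Graph n) (R : Fin n → Set) → IsTwinQuotientSet G R →
    (k : ℕ) (c : Fin n → Fin k) → IsRlidColoring G c →
    (K : List (Fin n)) → IsCliqueIn G R K →
    2 * length K ≤ 2 ^ k
mainTheorem9 n G R twin-quotient k c rlid K clique =
  decidable-stable (2 * length K ≤? 2 ^ k) λ ¬bound →
    ¬¬-Π-Fin (λ u → ¬¬-Π-Fin (λ i → ¬¬-excluded-middle)) λ colour? →
      ¬bound (ColourSets.clique-bound G c colour? twin-quotient rlid clique)
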